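{- Let $G$ be a graph, let $P = u_0 u_1\cdots u_\ell$ be a longest path in $G$ (with this fixed ordering of its vertices), and let $F$ and $F'$ be distinct components of $G\setminus V(P)$. For a component $C$ of $G\setminus V(P)$, let $N(C)$ be the set of vertices of $V(G)\setminus C$ adjacent to at least one vertex of $C$, and let $N(C)^- = \{u_{i-1} : u_i \in N(C)\}$. Then $|N(F)^- \cap N(F')| \leq 1$.
   Context: All graphs are finite, simple and undirected. A component of a graph is the vertex set of a maximal connected subgraph. Note that $N(C)\subseteq V(P)$ for such a component $C$. -}

module Defs where

open import Data.Nat using (ℕ; suc; _≤_)
open import Data.Fin using (Fin; inject₁) renaming (suc to fsuc)
open import Data.Fin.Subset using (Subset; _∈_; _∉_; _⊆_; Nonempty)
open import Data.Product using (Σ; ∃; _×_)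
open import Function.Definitions using (Injective)
open import Relation.Binary.PropositionalEquality using (_≡_)
open import Relation.Nullary using (¬_)
open import Level using (0ℓ)

record Graph (n : ℕ) : Set₁ where
  field
    Adj    : Fin n → Fin n → Set
    sym    : ∀ {x y} → Adj x y → Adj y x
    irrefl : ∀ {x} → ¬ Adj x x
open Graph public

module _ {n : ℕ} (G : Graph n) where

  IsPath : (ℓ : ℕ) → (Fin (suc ℓ) → Fin n) → Set
  IsPath ℓ P = Injective _≡_ _≡_ P × (∀ (i : Fin ℓ) → Adj G (P (inject₁ i)) (P (fsuc i)))

  IsLongestPath : (ℓ : ℕ) → (Fin (suc ℓ) → Fin n) → Set
  IsLongestPath ℓ P = IsPath ℓ P × (∀ (m : ℕ) (Q : Fin (suc m) → Fin n) → IsPath m Q → m ≤ ℓ)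

  OnPath : {ℓ : ℕ} → (Fin (suc ℓ) → Fin n) → Fin n → Set
  OnPath {ℓ} P x = Σ (Fin (suc ℓ)) λ i → P i ≡ x

  data WalkIn (S : Subset n) : Fin n → Fin n → Set where
    here : ∀ {x} → x ∈ S → WalkIn S x x
    step : ∀ {x y z} → x ∈ S → Adj G x y → WalkIn S y z → WalkIn S x z

  Connected : Subset n → Set
  Connected S = ∀ {x y} → x ∈ S → y ∈ S → WalkIn S x y

  IsComponentOff : {ℓ : ℕ} → (Fin (suc ℓ) → Fin n) → Subset n → Set
  IsComponentOff P C =
    Nonempty C
    × (∀ {x} → x ∈ C → ¬ OnPath P x)
    × Connected C
    × (∀ (D : Subset n) → C ⊆ D → (∀ {x} → x ∈ D → ¬ OnPath P x) → Connected D → D ⊆ C)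

  InN : Subset n → Fin n → Set
  InN C x = x ∉ C × ∃ λ y → y ∈ C × Adj G x y

  InNminus : {ℓ : ℕ} → (Fin (suc ℓ) → Fin n) → Subset n → Fin n → Set
  InNminus {ℓ} P C x = Σ (Fin ℓ) λ i → InN C (P (fsuc i)) × P (inject₁ i) ≡ x

-- If u_i and u_j (i < j) both have a neighbour in F′ while u_{i+1} and u_{j+1} both have a
-- neighbour in F, joining these neighbours by paths inside F′ and inside F gives the walk
--   u₀ ⋯ u_i ⟶ F′ ⟶ u_j u_{j-1} ⋯ u_{i+1} ⟶ F ⟶ u_{j+1} ⋯ u_ℓ.
-- Distinct components are disjoint and avoid P, so this is a path; it visits all of V(P) and
-- at least one vertex of each of F and F′, so it is longer than P.

module Submission where

open import Defs
open import Data.Nat using (ℕ; suc; _+_; _<_; s<s; z<s)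
open import Data.Nat.Properties using (suc-injective; m<m+n; <⇒≱)
open import Data.Fin as Fin using (Fin; zero; suc; inject₁; fromℕ)
open import Data.Fin.Properties using (<-cmp)
open import Data.Fin.Subset using (Subset; _∈_; _∉_; _⊆_; _∪_)
open import Data.Fin.Subset.Properties using (x∈p∪q⁻; p⊆p∪q; q⊆p∪q; ⊆-antisym)
open import Data.List as List using (List; []; _∷_; _++_; _∷ʳ_; drop; tabulate)
open import Data.List.Properties using (length-++; length-tabulate)
open import Data.List.Membership.Propositional using () renaming (_∈_ to _∈ₗ_)
open import Data.List.Relation.Unary.All as All using (All; []; _∷_)
open import Data.List.Relation.Unary.All.Properties as All using (¬Any⇒All¬)
open import Data.List.Relation.Unary.AllPairs using ([]; _∷_)
open import Data.List.Relation.Unary.Any using (here; there)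
open import Data.List.Relation.Unary.Unique.Propositional using (Unique)
open import Data.List.Relation.Unary.Unique.Propositional.Properties as Unique using ()
open import Data.List.Relation.Binary.Disjoint.Propositional using (Disjoint)
open import Data.List.Relation.Binary.Permutation.Propositional using (_↭_; ↭-refl; ↭-sym; ↭-trans; ↭-reflexive; ↭⇒↭ₛ; module PermutationReasoning)
open import Data.List.Relation.Binary.Permutation.Propositional.Properties using (↭-length; ++⁺ˡ; ++⁺ʳ; ∷↭∷ʳ; ++-commutativeMonoid)
open import Data.Product using (Σ-syntax; ∃-syntax; _×_; _,_)
open import Data.Sum using (inj₁; inj₂; [_,_]′)
open import Data.Empty using (⊥; ⊥-elim)
open import Function using (_∘_)
open import Function.Definitions using (Injective)
open import Relation.Binary.Definitions using (tri<; tri≈; tri>)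
open import Relation.Binary.PropositionalEquality as ≡ using (_≡_; _≢_; refl; cong; cong₂; subst; module ≡-Reasoning)
open import Relation.Nullary using (¬_; yes; no)
open import Relation.Unary using (Pred)
import Data.List.Relation.Binary.Permutation.Setoid.Properties as PermutationₛProperties

disjoint-by : ∀ {a p q} {A : Set a} {P : Pred A p} {Q : Pred A q} {xs ys : List A} →
              (∀ {v} → P v → Q v → ⊥) → All P xs → All Q ys → Disjoint xs ys
disjoint-by P⇒¬Q Pxs Qys (v∈xs , v∈ys) = P⇒¬Q (All.lookup Pxs v∈xs) (All.lookup Qys v∈ys)

module Walks {n : ℕ} (G : Graph n) where

  open import Data.List.Membership.DecPropositional (Fin._≟_ {n}) using (_∈?_)

  infixr 5 _∷⟨_⟩_ _++⟨_⟩_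

  data Walk : Fin n → Fin n → Set where
    [_]    : ∀ x → Walk x x
    _∷⟨_⟩_ : ∀ x {y z} → Adj G x y → Walk y z → Walk x z

  private variable
    x y z a b : Fin n

  length : Walk x z → ℕ
  length [ _ ]        = 0
  length (_ ∷⟨ _ ⟩ w) = suc (length w)

  vertices : Walk x z → List (Fin n)
  vertices [ x ]        = x ∷ []
  vertices (x ∷⟨ _ ⟩ w) = x ∷ vertices w

  vertex : (w : Walk x z) → Fin (suc (length w)) → Fin n
  vertex [ x ]        zero    = x
  vertex (x ∷⟨ _ ⟩ w) zero    = x
  vertex (_ ∷⟨ _ ⟩ w) (suc i) = vertex w i

  _++⟨_⟩_ : Walk x a → Adj G a b → Walk b z → Walk x z
  [ x ]          ++⟨ e ⟩ w = x ∷⟨ e ⟩ w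
  (x ∷⟨ e′ ⟩ v) ++⟨ e ⟩ w = x ∷⟨ e′ ⟩ (v ++⟨ e ⟩ w)

  reverse : Walk x z → Walk z x
  reverse [ x ]        = [ x ]
  reverse (x ∷⟨ e ⟩ w) = reverse w ++⟨ sym G e ⟩ [ x ]

  length-vertices : (w : Walk x z) → List.length (vertices w) ≡ suc (length w)
  length-vertices [ x ]        = refl
  length-vertices (x ∷⟨ _ ⟩ w) = cong suc (length-vertices w)

  vertices-++ : (v : Walk x a) (e : Adj G a b) (w : Walk b z) →
                vertices (v ++⟨ e ⟩ w) ≡ vertices v ++ vertices w
  vertices-++ [ x ]        e w = refl
  vertices-++ (x ∷⟨ _ ⟩ v) e w = cong (x ∷_) (vertices-++ v e w)

  vertices-reverse : (w : Walk x z) → vertices (reverse w) ↭ vertices w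
  vertices-reverse [ x ]        = ↭-refl
  vertices-reverse (x ∷⟨ e ⟩ w) = begin
    vertices (reverse w ++⟨ sym G e ⟩ [ x ]) ≡⟨ vertices-++ (reverse w) (sym G e) [ x ] ⟩
    vertices (reverse w) ∷ʳ x                ↭⟨ ++⁺ʳ (x ∷ []) (vertices-reverse w) ⟩
    vertices w ∷ʳ x                          ↭⟨ ∷↭∷ʳ x (vertices w) ⟨
    x ∷ vertices w                           ∎
    where open PermutationReasoning

  vertex-zero : (w : Walk x z) → vertex w zero ≡ x
  vertex-zero [ x ]        = refl
  vertex-zero (x ∷⟨ _ ⟩ w) = refl

  vertex-∈ : (w : Walk x z) (i : Fin (suc (length w))) → vertex w i ∈ₗ vertices w
  vertex-∈ [ x ]        zero    = here refl
  vertex-∈ (x ∷⟨ _ ⟩ w) zero    = here refl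
  vertex-∈ (x ∷⟨ _ ⟩ w) (suc i) = there (vertex-∈ w i)

  vertex-adjacent : (w : Walk x z) (i : Fin (length w)) →
                    Adj G (vertex w (inject₁ i)) (vertex w (suc i))
  vertex-adjacent (x ∷⟨ e ⟩ w) zero    = subst (Adj G x) (≡.sym (vertex-zero w)) e
  vertex-adjacent (x ∷⟨ _ ⟩ w) (suc i) = vertex-adjacent w i

  vertex-injective : (w : Walk x z) → Unique (vertices w) → Injective _≡_ _≡_ (vertex w)
  vertex-injective [ x ]        _          {zero}  {zero}  _  = refl
  vertex-injective (x ∷⟨ _ ⟩ w) _          {zero}  {zero}  _  = refl
  vertex-injective (x ∷⟨ _ ⟩ w) (x∉w ∷ _)  {zero}  {suc j} eq = ⊥-elim (All.lookup x∉w (vertex-∈ w j) eq)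
  vertex-injective (x ∷⟨ _ ⟩ w) (x∉w ∷ _)  {suc i} {zero}  eq = ⊥-elim (All.lookup x∉w (vertex-∈ w i) (≡.sym eq))
  vertex-injective (x ∷⟨ _ ⟩ w) (_ ∷ uniq) {suc i} {suc j} eq = cong suc (vertex-injective w uniq eq)

  unique⇒isPath : (w : Walk x z) → Unique (vertices w) → IsPath G (length w) (vertex w)
  unique⇒isPath w uniq = vertex-injective w uniq , vertex-adjacent w

  suffixFrom : (w : Walk y z) → x ∈ₗ vertices w →
               Σ[ w′ ∈ Walk x z ] ∃[ k ] vertices w′ ≡ drop k (vertices w)
  suffixFrom [ y ]           (here refl) = [ y ] , 0 , refl
  suffixFrom w@(y ∷⟨ _ ⟩ _) (here refl) = w , 0 , refl
  suffixFrom (y ∷⟨ _ ⟩ w)   (there x∈w) = let w′ , k , eq = suffixFrom w x∈w in w′ , suc k , eq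

  simplify : ∀ {S} → WalkIn G S x z →
             Σ[ w ∈ Walk x z ] Unique (vertices w) × All (_∈ S) (vertices w)
  simplify (here x∈S) = [ _ ] , [] ∷ [] , x∈S ∷ []
  simplify {x = x} (step x∈S e rest) with simplify rest
  ... | w , uniq , inS with x ∈? vertices w
  ...   | yes x∈w = let w′ , k , eq = suffixFrom w x∈w in
                    w′ , subst Unique (≡.sym eq) (Unique.drop⁺ k uniq) , subst (All _) (≡.sym eq) (All.drop⁺ k inS)
  ...   | no  x∉w = x ∷⟨ e ⟩ w , ¬Any⇒All¬ _ x∉w ∷ uniq , x∈S ∷ inS

  detour-vertices : ∀ {x a a⁺ b b⁺ z a′ b′ c d}
    (A : Walk x a) (B : Walk a⁺ b) (C : Walk b⁺ z) (W′ : Walk a′ b′) (W : Walk c d)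
    (e₁ : Adj G a a′) (e₂ : Adj G b′ b) (e₃ : Adj G a⁺ c) (e₄ : Adj G d b⁺) →
    vertices (A ++⟨ e₁ ⟩ W′ ++⟨ e₂ ⟩ reverse B ++⟨ e₃ ⟩ W ++⟨ e₄ ⟩ C)
      ↭ (vertices A ++ vertices B ++ vertices C) ++ vertices W′ ++ vertices W
  detour-vertices A B C W′ W e₁ e₂ e₃ e₄ = begin
    vertices (A ++⟨ e₁ ⟩ W′ ++⟨ e₂ ⟩ reverse B ++⟨ e₃ ⟩ W ++⟨ e₄ ⟩ C)
      ≡⟨ vertices-++ A e₁ _ ⟩
    vA ++ vertices (W′ ++⟨ e₂ ⟩ reverse B ++⟨ e₃ ⟩ W ++⟨ e₄ ⟩ C)
      ≡⟨ cong (vA ++_) (vertices-++ W′ e₂ _) ⟩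
    vA ++ vW′ ++ vertices (reverse B ++⟨ e₃ ⟩ W ++⟨ e₄ ⟩ C)
      ≡⟨ cong (λ vs → vA ++ vW′ ++ vs) (vertices-++ (reverse B) e₃ _) ⟩
    vA ++ vW′ ++ vertices (reverse B) ++ vertices (W ++⟨ e₄ ⟩ C)
      ≡⟨ cong (λ vs → vA ++ vW′ ++ vertices (reverse B) ++ vs) (vertices-++ W e₄ C) ⟩
    vA ++ vW′ ++ vertices (reverse B) ++ vW ++ vC
      ↭⟨ ++⁺ˡ vA (++⁺ˡ vW′ (++⁺ʳ (vW ++ vC) (vertices-reverse B))) ⟩
    vA ++ vW′ ++ vB ++ vW ++ vC
      ↭⟨ rearrange vA vW′ vB vW vC ⟩
    (vA ++ vB ++ vC) ++ vW′ ++ vW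
      ∎
    where
    open PermutationReasoning
    open import Algebra.Solver.CommutativeMonoid (++-commutativeMonoid {A = Fin n}) using (solve; _⊜_; _⊕_)
    rearrange : ∀ a w′ b w c → a ++ w′ ++ b ++ w ++ c ↭ (a ++ b ++ c) ++ w′ ++ w
    rearrange = solve 5 (λ a w′ b w c → (a ⊕ (w′ ⊕ (b ⊕ (w ⊕ c)))) ⊜ ((a ⊕ (b ⊕ c)) ⊕ (w′ ⊕ w))) ↭-refl
    vA = vertices A
    vB = vertices B
    vC = vertices C
    vW = vertices W
    vW′ = vertices W′

module _ {n : ℕ} {G : Graph n} where

  open Walks G

  path-walk : ∀ {ℓ} (P : Fin (suc ℓ) → Fin n) → (∀ i → Adj G (P (inject₁ i)) (P (suc i))) →
              Σ[ w ∈ Walk (P zero) (P (fromℕ ℓ)) ] vertices w ≡ tabulate P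
  path-walk {ℓ = 0}     P adj = [ P zero ] , refl
  path-walk {ℓ = suc _} P adj =
    let w , eq = path-walk (P ∘ suc) (adj ∘ suc) in P zero ∷⟨ adj zero ⟩ w , cong (P zero ∷_) eq

  path-cut : ∀ {ℓ} (P : Fin (suc ℓ) → Fin n) → (∀ i → Adj G (P (inject₁ i)) (P (suc i))) →
             (i : Fin ℓ) →
             Σ[ A ∈ Walk (P zero) (P (inject₁ i)) ]
             Σ[ C ∈ Walk (P (suc i)) (P (fromℕ ℓ)) ]
             vertices A ++ vertices C ≡ tabulate P
  path-cut P adj zero =
    let C , eq = path-walk (P ∘ suc) (adj ∘ suc) in [ P zero ] , C , cong (P zero ∷_) eq
  path-cut P adj (suc i) =
    let A , C , eq = path-cut (P ∘ suc) (adj ∘ suc) i in P zero ∷⟨ adj zero ⟩ A , C , cong (P zero ∷_) eq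

  path-cut₂ : ∀ {ℓ} (P : Fin (suc ℓ) → Fin n) → (∀ i → Adj G (P (inject₁ i)) (P (suc i))) →
              {i j : Fin ℓ} → i Fin.< j →
              Σ[ A ∈ Walk (P zero) (P (inject₁ i)) ]
              Σ[ B ∈ Walk (P (suc i)) (P (inject₁ j)) ]
              Σ[ C ∈ Walk (P (suc j)) (P (fromℕ ℓ)) ]
              vertices A ++ vertices B ++ vertices C ≡ tabulate P
  path-cut₂ P adj {zero} {suc j} _ =
    let B , C , eq = path-cut (P ∘ suc) (adj ∘ suc) j in [ P zero ] , B , C , cong (P zero ∷_) eq
  path-cut₂ P adj {suc i} {suc j} (s<s i<j) =
    let A , B , C , eq = path-cut₂ (P ∘ suc) (adj ∘ suc) i<j in P zero ∷⟨ adj zero ⟩ A , B , C , cong (P zero ∷_) eq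

  private variable
    S T : Subset n
    x y z : Fin n

  WalkIn-mono : S ⊆ T → WalkIn G S x y → WalkIn G T x y
  WalkIn-mono S⊆T (here x∈S)     = here (S⊆T x∈S)
  WalkIn-mono S⊆T (step x∈S e w) = step (S⊆T x∈S) e (WalkIn-mono S⊆T w)

  _◅◅_ : WalkIn G S x y → WalkIn G S y z → WalkIn G S x z
  here _       ◅◅ w′ = w′
  step x∈S e w ◅◅ w′ = step x∈S e (w ◅◅ w′)

  ∪-connected : Connected G S → Connected G T → z ∈ S → z ∈ T → Connected G (S ∪ T)
  ∪-connected {S} {T} connS connT z∈S z∈T x∈ y∈ with x∈p∪q⁻ S T x∈ | x∈p∪q⁻ S T y∈
  ... | inj₁ x∈S | inj₁ y∈S = WalkIn-mono (p⊆p∪q T) (connS x∈S y∈S)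
  ... | inj₁ x∈S | inj₂ y∈T = WalkIn-mono (p⊆p∪q T) (connS x∈S z∈S) ◅◅ WalkIn-mono (q⊆p∪q S T) (connT z∈T y∈T)
  ... | inj₂ x∈T | inj₁ y∈S = WalkIn-mono (q⊆p∪q S T) (connT x∈T z∈T) ◅◅ WalkIn-mono (p⊆p∪q T) (connS z∈S y∈S)
  ... | inj₂ x∈T | inj₂ y∈T = WalkIn-mono (q⊆p∪q S T) (connT x∈T y∈T)

  components-disjoint : ∀ {ℓ} {P : Fin (suc ℓ) → Fin n} {F F′ : Subset n} →
                        IsComponentOff G P F → IsComponentOff G P F′ → F ≢ F′ → x ∈ F → x ∉ F′
  components-disjoint {P = P} {F} {F′} (_ , avoidF , connF , maxF) (_ , avoidF′ , connF′ , maxF′) F≢F′ x∈F x∈F′ =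
    F≢F′ (⊆-antisym (F∪F′⊆F′ ∘ p⊆p∪q F′) (F∪F′⊆F ∘ q⊆p∪q F F′))
    where
    avoid : ∀ {v} → v ∈ F ∪ F′ → ¬ OnPath G P v
    avoid v∈ = [ avoidF , avoidF′ ]′ (x∈p∪q⁻ F F′ v∈)
    conn = ∪-connected connF connF′ x∈F x∈F′
    F∪F′⊆F = maxF (F ∪ F′) (p⊆p∪q F′) avoid conn
    F∪F′⊆F′ = maxF′ (F ∪ F′) (q⊆p∪q F F′) avoid conn

module _ {n : ℕ} (G : Graph n) where

  LongerPath : ℕ → Set
  LongerPath ℓ = Σ[ m ∈ ℕ ] Σ[ Q ∈ (Fin (suc m) → Fin n) ] IsPath G m Q × ℓ < m

  longest⇒¬LongerPath : ∀ {ℓ P} → IsLongestPath G ℓ P → ¬ LongerPath ℓ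
  longest⇒¬LongerPath (_ , longest) (m , Q , isQ , ℓ<m) = <⇒≱ ℓ<m (longest m Q isQ)

module _ {n : ℕ} {G : Graph n} where

  open Walks G
  open PermutationₛProperties (≡.setoid (Fin n)) using (Unique-resp-↭)

  crossing⇒longer-path :
    ∀ {ℓ} {P : Fin (suc ℓ) → Fin n} {F F′ : Subset n} → IsPath G ℓ P →
    IsComponentOff G P F → IsComponentOff G P F′ → F ≢ F′ →
    ∀ {i j : Fin ℓ} → i Fin.< j →
    InN G F (P (suc i)) → InN G F′ (P (inject₁ i)) →
    InN G F (P (suc j)) → InN G F′ (P (inject₁ j)) →
    LongerPath G ℓ
  crossing⇒longer-path {ℓ} {P} (P-injective , P-adjacent)
    compF@(_ , avoidF , connF , _) compF′@(_ , avoidF′ , connF′ , _) F≢F′ i<j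
    (_ , c , c∈F , i⁺~c) (_ , a , a∈F′ , i~a) (_ , d , d∈F , j⁺~d) (_ , b , b∈F′ , j~b)
    with path-cut₂ P P-adjacent i<j
       | simplify (connF c∈F d∈F)
       | simplify (connF′ a∈F′ b∈F′)
  ... | A , B , C , P≡ABC | W , W-unique , W⊆F | W′ , W′-unique , W′⊆F′ =
    length T , vertex T , unique⇒isPath T T-unique , ℓ<|T|
    where
    T = A ++⟨ i~a ⟩ W′ ++⟨ sym G j~b ⟩ reverse B ++⟨ i⁺~c ⟩ W ++⟨ sym G j⁺~d ⟩ C

    T↭P+W′+W : vertices T ↭ tabulate P ++ vertices W′ ++ vertices W
    T↭P+W′+W = ↭-trans (detour-vertices A B C W′ W _ _ _ _) (↭-reflexive (cong (_++ _) P≡ABC))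

    W′#W : Disjoint (vertices W′) (vertices W)
    W′#W = disjoint-by (λ v∈F′ v∈F → components-disjoint compF compF′ F≢F′ v∈F v∈F′) W′⊆F′ W⊆F

    P#W′W : Disjoint (tabulate P) (vertices W′ ++ vertices W)
    P#W′W = disjoint-by (λ onP offP → offP onP) (All.tabulate⁺ (λ k → k , refl))
                        (All.++⁺ (All.map avoidF′ W′⊆F′) (All.map avoidF W⊆F))

    T-unique : Unique (vertices T)
    T-unique = Unique-resp-↭ (↭⇒↭ₛ (↭-sym T↭P+W′+W))
      (Unique.++⁺ (Unique.tabulate⁺ P-injective) (Unique.++⁺ W′-unique W-unique W′#W) P#W′W)

    |T| : length T ≡ ℓ + (suc (length W′) + suc (length W))
    |T| = suc-injective (begin
      suc (length T)                                                 ≡⟨ length-vertices T ⟨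
      List.length (vertices T)                                       ≡⟨ ↭-length T↭P+W′+W ⟩
      List.length (tabulate P ++ vertices W′ ++ vertices W)          ≡⟨ length-++ (tabulate P) ⟩
      List.length (tabulate P) + List.length (vertices W′ ++ vertices W)
        ≡⟨ cong₂ _+_ (length-tabulate P) (length-++ (vertices W′)) ⟩
      suc ℓ + (List.length (vertices W′) + List.length (vertices W))
        ≡⟨ cong (suc ℓ +_) (cong₂ _+_ (length-vertices W′) (length-vertices W)) ⟩
      suc ℓ + (suc (length W′) + suc (length W))                     ∎)
      where open ≡-Reasoning

    ℓ<|T| : ℓ < length T
    ℓ<|T| = subst (ℓ <_) (≡.sym |T|) (m<m+n ℓ z<s)

lemma8 : ∀ {n : ℕ} (G : Graph n) (ℓ : ℕ) (P : Fin (suc ℓ) → Fin n) (F F' : Subset n)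
         → IsLongestPath G ℓ P
         → IsComponentOff G P F → IsComponentOff G P F' → F ≢ F'
         → ∀ (x y : Fin n)
         → InNminus G P F x × InN G F' x
         → InNminus G P F y × InN G F' y
         → x ≡ y
lemma8 G _ _ _ _ longest@(isPath , _) compF compF' F≢F' _ _
  ((i , i⁺∈NF , refl) , i∈NF') ((j , j⁺∈NF , refl) , j∈NF') with <-cmp i j
... | tri< i<j _ _ = ⊥-elim (longest⇒¬LongerPath G longest
                       (crossing⇒longer-path isPath compF compF' F≢F' i<j i⁺∈NF i∈NF' j⁺∈NF j∈NF'))
... | tri≈ _ refl _ = refl
... | tri> _ _ j<i = ⊥-elim (longest⇒¬LongerPath G longest
                       (crossing⇒longer-path isPath compF compF' F≢F' j<i j⁺∈NF j∈NF' i⁺∈NF i∈NF'))
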